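{- Let $P_4^+$ be the tree with vertices $x_1,x_2,x_3,x_4,x_3'$ and edges $x_1x_2,x_2x_3,x_3x_4,x_3x_3'$ (a path on four vertices with one extra leaf attached to an internal vertex). Bob has a winning strategy in the $2$-Expanded Coloring Game played on the uncolored $P_4^+$.
   Context: The $k$-coloring game on a (possibly partially colored, properly) graph with a set $C$ of $k$ colors: a color is legal for a vertex $v$ if no neighbor of $v$ has that color. Alice and Bob alternately color uncolored vertices with legal colors, Alice moving first. If at any point some uncolored vertex has no legal color, Bob wins; Alice wins once every vertex is colored. The $k$-Expanded Coloring Game is the same except that on her turn Alice may choose not to color a vertex, and if so she may instead add a single new leaf (a new vertex adjacent to exactly one existing vertex) already colored with one of the $k$ colors. -}

module Defs where

open import Data.Nat using (ℕ; zero; suc)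
open import Data.Fin using (Fin; zero; suc; toℕ; _≟_)
open import Data.Bool using (Bool; true; false; _∨_; if_then_else_)
open import Data.Maybe using (Maybe; just; nothing)
open import Data.Product using (Σ; ∃; _×_; _,_)
open import Data.Sum using (_⊎_)
open import Relation.Nullary using (¬_)
open import Relation.Nullary.Decidable using (⌊_⌋)
open import Relation.Binary.PropositionalEquality using (_≡_; _≢_)

-- A finite simple graph on vertex set Fin n (symmetric, loopless adjacency),
-- partially coloured with colours from Fin k (nothing = uncoloured).
record State (k : ℕ) : Set where
  constructor mkState
  field
    n   : ℕ
    adj : Fin n → Fin n → Bool
    col : Fin n → Maybe (Fin k)
open State public

Legal : ∀ {k} (s : State k) → Fin k → Fin (n s) → Set
Legal s c v = ∀ u → adj s v u ≡ true → col s u ≢ just c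

Stuck : ∀ {k} → State k → Set
Stuck s = ∃ λ v → col s v ≡ nothing × (∀ c → ¬ Legal s c v)

AllColored : ∀ {k} → State k → Set
AllColored s = ∀ v → col s v ≢ nothing

colorAt : ∀ {k} (s : State k) → Fin (n s) → Fin k → State k
colorAt s v c = mkState (n s) (adj s)
  (λ u → if ⌊ u ≟ v ⌋ then just c else col s u)

addLeaf : ∀ {k} (s : State k) → Fin (n s) → Fin k → State k
addLeaf {k} s v c = mkState (suc (n s)) adj' col'
  where
  adj' : Fin (suc (n s)) → Fin (suc (n s)) → Bool
  adj' zero    zero    = false
  adj' zero    (suc j) = ⌊ j ≟ v ⌋
  adj' (suc i) zero    = ⌊ i ≟ v ⌋
  adj' (suc i) (suc j) = adj s i j
  col' : Fin (suc (n s)) → Maybe (Fin k)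
  col' zero    = just c
  col' (suc i) = col s i

data ColorMove {k} (s : State k) : State k → Set where
  color : ∀ v c → col s v ≡ nothing → Legal s c v → ColorMove s (colorAt s v c)

-- Alice's moves in the k-Expanded Coloring Game: a colouring move, or adding
-- a new leaf already coloured (properly: its colour differs from the colour
-- of its unique neighbour, if that neighbour is coloured)
data AliceMove {k} (s : State k) : State k → Set where
  aliceColor : ∀ {s'} → ColorMove s s' → AliceMove s s'
  aliceLeaf  : ∀ v c → col s v ≢ just c → AliceMove s (addLeaf s v c)

-- Bob can force a win: BobWinsA = Alice to move, BobWinsB = Bob to move.
-- Inductive, so the win is reached after finitely many moves.
mutual
  data BobWinsA {k} (s : State k) : Set where
    stuckA : Stuck s → BobWinsA s
    stepA  : ¬ AllColored s → (∀ s' → AliceMove s s' → BobWinsB s') → BobWinsA s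

  data BobWinsB {k} (s : State k) : Set where
    stuckB : Stuck s → BobWinsB s
    stepB  : ∀ s' → ColorMove s s' → BobWinsA s' → BobWinsB s

-- P4+ : x1=0, x2=1, x3=2, x4=3, x3'=4 ; edges x1x2, x2x3, x3x4, x3x3'
isEdge : ℕ → ℕ → Bool
isEdge 0 1 = true
isEdge 1 2 = true
isEdge 2 3 = true
isEdge 2 4 = true
isEdge _ _ = false

P4plus : State 2
P4plus = mkState 5
  (λ i j → isEdge (toℕ i) (toℕ j) ∨ isEdge (toℕ j) (toℕ i))
  (λ _ → nothing)

-- Bob's strategy is a single "fork": whatever Alice does first, Bob answers
-- with one colouring move after which some uncoloured vertex w sees both
-- colours among its neighbours, so the position is stuck and Bob has won.
--   * If Alice colours v with c, Bob picks an uncoloured neighbour w of v and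
--     colours a vertex b at distance two from v (a neighbour of w) with the
--     other colour.
--   * If Alice attaches a leaf of colour c to v, then w = v: Bob colours any
--     neighbour b of v with the other colour.
-- In both cases every neighbour of b is still uncoloured, so Bob's move is
-- legal whatever c is.
module Submission where

open import Defs
open import Data.Fin using (Fin; zero; suc; _≟_)
open import Data.Fin.Properties using (all?)
open import Data.Bool using (true)
open import Data.Bool.Properties using () renaming (_≟_ to _≟ᵇ_)
open import Data.Maybe using (Maybe; just; nothing)
open import Data.Product using (∃; _×_; _,_)
open import Data.Sum using (_⊎_; inj₁; inj₂)
open import Relation.Nullary using (Dec; yes; no)
open import Relation.Nullary.Decidable using (dec-no; dec-yes-recompute; _→-dec_; True; toWitness)
open import Relation.Binary.PropositionalEquality using (_≡_; _≢_; refl; subst; sym; trans)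

colorAt-other : ∀ {k} (s : State k) {u v : Fin (n s)} {c : Fin k} →
                u ≢ v → col (colorAt s v c) u ≡ col s u
colorAt-other s {u} {v} u≢v rewrite dec-no (u ≟ v) u≢v = refl

colorAt-self : ∀ {k} (s : State k) {v : Fin (n s)} {c : Fin k} →
               col (colorAt s v c) v ≡ just c
colorAt-self s {v} rewrite dec-yes-recompute (v ≟ v) refl = refl

seesAllColours⇒stuck : ∀ {k} (s : State k) (w : Fin (n s)) → col s w ≡ nothing →
  (∀ c → ∃ λ u → adj s w u ≡ true × col s u ≡ just c) → Stuck s
seesAllColours⇒stuck s w free sees = w , free , λ c legal →
  let (u , w~u , u-has-c) = sees c in legal u w~u u-has-c

FreeNeighbourhood : ∀ {k} (s : State k) → Fin (n s) → Set
FreeNeighbourhood s b = ∀ u → adj s b u ≡ true → col s u ≡ nothing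

free⇒legal : ∀ {k} (s : State k) {b : Fin (n s)} {c : Fin k} →
             FreeNeighbourhood s b → Legal s c b
free⇒legal s free u b~u u-has-c with () ← subst (_≡ just _) (free u b~u) u-has-c

-- Uncolouredness of a vertex is decidable, hence so is FreeNeighbourhood;
-- on concrete positions the decision procedure yields the proof.
uncoloured? : ∀ {k} (m : Maybe (Fin k)) → Dec (m ≡ nothing)
uncoloured? nothing  = yes refl
uncoloured? (just _) = no λ ()

freeNeighbourhood? : ∀ {k} (s : State k) (b : Fin (n s)) → Dec (FreeNeighbourhood s b)
freeNeighbourhood? s b =
  all? λ u → (adj s b u ≟ᵇ true) →-dec uncoloured? (col s u)

opposite : Fin 2 → Fin 2
opposite zero       = suc zero
opposite (suc zero) = zero

c-or-opposite : ∀ c c′ → c′ ≡ c ⊎ c′ ≡ opposite c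
c-or-opposite zero       zero       = inj₁ refl
c-or-opposite zero       (suc zero) = inj₂ refl
c-or-opposite (suc zero) zero       = inj₂ refl
c-or-opposite (suc zero) (suc zero) = inj₁ refl

fork : (s : State 2) {w u b : Fin (n s)} {c : Fin 2} →
       col s w ≡ nothing → adj s w u ≡ true → col s u ≡ just c →
       adj s w b ≡ true → w ≢ b → col s b ≡ nothing → Legal s (opposite c) b →
       BobWinsB s
fork s {w} {u} {b} {c} w-free w~u u-has-c w~b w≢b b-free b-legal =
  stepB _ (color b (opposite c) b-free b-legal) (stuckA (seesAllColours⇒stuck s′ w
    (trans (colorAt-other s w≢b) w-free) seesBoth))
  where
  s′ : State 2
  s′ = colorAt s b (opposite c)

  u≢b : u ≢ b
  u≢b refl with () ← trans (sym u-has-c) b-free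

  seesBoth : ∀ c′ → ∃ λ x → adj s′ w x ≡ true × col s′ x ≡ just c′
  seesBoth c′ with c-or-opposite c c′
  ... | inj₁ refl = u , w~u , trans (colorAt-other s u≢b) u-has-c
  ... | inj₂ refl = b , w~b , colorAt-self s

forkOn : (s : State 2) (w u b : Fin (n s)) {c : Fin 2} →
         col s w ≡ nothing → adj s w u ≡ true → col s u ≡ just c →
         adj s w b ≡ true → w ≢ b → col s b ≡ nothing →
         {b-nbhd : True (freeNeighbourhood? s b)} → BobWinsB s
forkOn s w u b w-free w~u u-has-c w~b w≢b b-free {b-nbhd} =
  fork s w-free w~u u-has-c w~b w≢b b-free (free⇒legal s (toWitness b-nbhd))

pattern x₁  = zero
pattern x₂  = suc zero
pattern x₃  = suc (suc zero)
pattern x₄  = suc (suc (suc zero))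
pattern x₃′ = suc (suc (suc (suc zero)))

-- Bob's reply when Alice colours v with c: (w, u, b) with u = v, w an
-- uncoloured neighbour of v and b a neighbour of w at distance two from v.
afterColouring : (v : Fin 5) (c : Fin 2) → BobWinsB (colorAt P4plus v c)
afterColouring x₁  c = forkOn _ x₂ x₁  x₃ refl refl refl refl (λ ()) refl
afterColouring x₂  c = forkOn _ x₃ x₂  x₄ refl refl refl refl (λ ()) refl
afterColouring x₃  c = forkOn _ x₂ x₃  x₁ refl refl refl refl (λ ()) refl
afterColouring x₄  c = forkOn _ x₃ x₄  x₂ refl refl refl refl (λ ()) refl
afterColouring x₃′ c = forkOn _ x₃ x₃′ x₂ refl refl refl refl (λ ()) refl

-- Bob's reply when Alice attaches a leaf of colour c to v.  The new leaf is
-- vertex zero and old vertices are shifted by suc; w = v, u = the new leaf,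
-- b = a neighbour of v.
afterLeaf : (v : Fin 5) (c : Fin 2) → BobWinsB (addLeaf P4plus v c)
afterLeaf x₁  c = forkOn _ (suc x₁)  zero (suc x₂) refl refl refl refl (λ ()) refl
afterLeaf x₂  c = forkOn _ (suc x₂)  zero (suc x₁) refl refl refl refl (λ ()) refl
afterLeaf x₃  c = forkOn _ (suc x₃)  zero (suc x₂) refl refl refl refl (λ ()) refl
afterLeaf x₄  c = forkOn _ (suc x₄)  zero (suc x₃) refl refl refl refl (λ ()) refl
afterLeaf x₃′ c = forkOn _ (suc x₃′) zero (suc x₃) refl refl refl refl (λ ()) refl

lemma4p2 : BobWinsA P4plus
lemma4p2 = stepA (λ allColoured → allColoured x₁ refl) bobAnswers
  where
  bobAnswers : ∀ s′ → AliceMove P4plus s′ → BobWinsB s′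
  bobAnswers _ (aliceColor (color v c _ _)) = afterColouring v c
  bobAnswers _ (aliceLeaf v c _)            = afterLeaf v c
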